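{- Let $k$ be a quadratic étale algebra over $\mathbb{Q}$, $m\ge1$, and $\mathfrak a$ an integral ideal of $\mathcal{O}_{k,m}$. Let $c$ be the smallest positive integer with $c\cdot1\in\mathfrak a+m\mathcal{O}_k$. Then $m'=m/c$ is an integer, $\mathfrak a+m\mathcal{O}_k=c\,\mathcal{O}_{k,m'}$, and $c^{ -1}\mathfrak a\,\mathcal{O}_{k,m'}$ is an integral $\mathcal{O}_{k,m'}$-ideal prime to the conductor of $\mathcal{O}_{k,m'}$, i.e. $c^{ -1}\mathfrak a\,\mathcal{O}_{k,m'}+m'\mathcal{O}_k=\mathcal{O}_{k,m'}$.
   Context: $k$ is a quadratic field or $\mathbb{Q}\oplus\mathbb{Q}$ (with $\mathbb{Q}$ embedded diagonally), $\mathcal{O}_k$ its maximal order, $\mathcal{O}_{k,m}=\mathbb{Z}\cdot1+m\mathcal{O}_k$, whose conductor is $m\mathcal{O}_k$. An integral ideal of an order is an ideal of the ring. -}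

module Defs where

open import Data.Nat as ℕ using (ℕ; NonZero)
open import Data.Integer as ℤ using (ℤ; +_; _+_; _*_; -_; _-_; ∣_∣)
open import Data.Integer.DivMod using (_%ℕ_; _/_)
open import Data.Integer.Divisibility using (_∣_)
open import Data.Nat.Divisibility as ℕD using ()
open import Data.Product using (Σ; ∃; ∃-syntax; _×_; _,_)
open import Data.List using (List; []; _∷_)
open import Data.List.Relation.Unary.All using (All)
open import Data.Bool using (if_then_else_)
open import Relation.Nullary.Decidable using (⌊_⌋)
open import Relation.Binary.PropositionalEquality using (_≡_)

-- Squarefree integer (excludes 0, since 0*0 ∣ 0).
SquareFree : ℤ → Set
SquareFree D = ∀ (n : ℕ) → (n ℕ.* n) ℕD.∣ ∣ D ∣ → n ≡ 1

-- k = Q[x]/(x² - D), D squarefree (D = 1 gives Q ⊕ Q).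
-- Maximal order O_k = Z ⊕ Z ω with
--   ω = √D          if D ≢ 1 (mod 4)   (ω² = D)
--   ω = (1 + √D)/2  if D ≡ 1 (mod 4)   (ω² = ω + (D-1)/4)
-- Write ω² = t ω + n.
isOneMod4 : ℤ → _
isOneMod4 D = ⌊ (D %ℕ 4) ℕ.≟ 1 ⌋

ωt : ℤ → ℤ
ωt D = if isOneMod4 D then + 1 else + 0

ωn : ℤ → ℤ
ωn D = if isOneMod4 D then (D - + 1) / (+ 4) else D

-- Elements of O_k: (a , b) represents a + b ω.
O : Set
O = ℤ × ℤ

_⊕_ : O → O → O
(a , b) ⊕ (c , d) = (a + c , b + d)

⊖_ : O → O
⊖ (a , b) = (- a , - b)

0O : O
0O = (+ 0 , + 0)

1O : O
1O = (+ 1 , + 0)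

mul : ℤ → O → O → O
mul D (a , b) (c , d) =
  (a * c + b * d * ωn D , a * d + b * c + b * d * ωt D)

_·_ : ℤ → O → O
z · (a , b) = (z * a , z * b)

Subset : Set₁
Subset = O → Set

mOk : ℕ → Subset
mOk m (a , b) = (+ m ∣ a) × (+ m ∣ b)

-- O_{k,m} = Z·1 + m O_k = { a + b ω : m ∣ b }
Ord : ℕ → Subset
Ord m (a , b) = + m ∣ b

_⊆_ : Subset → Subset → Set
P ⊆ Q = ∀ x → P x → Q x

_≐_ : Subset → Subset → Set
P ≐ Q = (P ⊆ Q) × (Q ⊆ P)

_+S_ : Subset → Subset → Subset
(P +S Q) z = ∃[ x ] ∃[ y ] (P x × Q y × z ≡ x ⊕ y)

_·S_ : ℤ → Subset → Subset
(c ·S P) z = ∃[ y ] (P y × z ≡ c · y)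

-- c⁻¹ P ∩ O_k = { y ∈ O_k : c·y ∈ P }
inv·S : ℤ → Subset → Subset
inv·S c P y = P (c · y)

sumProd : ℤ → List (O × O) → O
sumProd D [] = 0O
sumProd D ((x , y) ∷ ps) = mul D x y ⊕ sumProd D ps

ProdS : ℤ → Subset → Subset → Subset
ProdS D P Q z = ∃[ ps ] (All (λ { (x , y) → P x × Q y }) ps × z ≡ sumProd D ps)

record IsIdeal (D : ℤ) (m : ℕ) (I : Subset) : Set where
  field
    sub   : I ⊆ Ord m
    zero∈ : I 0O
    +-cl  : ∀ x y → I x → I y → I (x ⊕ y)
    neg-cl : ∀ x → I x → I (⊖ x)
    mul-cl : ∀ r x → Ord m r → I x → I (mul D r x)

open import Data.Unit using (⊤)
Ok : Subset
Ok _ = ⊤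

{-# OPTIONS --safe #-}
-- S = 𝔞 + m O_k is an ideal of O_{k,m} containing m O_k. Its integers form c ℤ
-- (division with remainder against the least c), so c ∣ m; and a + bω ∈ S has
-- m ∣ b, hence c ∣ a after subtracting bω ∈ m O_k, which gives S = c O_{k,m'}.
-- Writing c = α + v with α ∈ 𝔞 and v ∈ m O_k = c m' O_k shows that c⁻¹𝔞 contains
-- an element x ≡ 1 modulo m' O_k, and then every z ∈ O_{k,m'} splits as
-- x z + (1 − x) z ∈ c⁻¹𝔞 O_{k,m'} + m' O_k.
module Submission where

open import Defs
open import Data.Nat using (ℕ; zero; suc; _<_; _*_; z<s; NonZero)
import Data.Nat.Divisibility as ℕ
open import Data.Integer as ℤ using (ℤ; +_; _+_; -_; _-_)
import Data.Integer.Properties as ℤ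
import Data.Integer.Divisibility as Unsigned
open import Data.Integer.Divisibility.Signed
  using (_∣_; divides; ∣ᵤ⇒∣; ∣⇒∣ᵤ; ∣m∣n⇒∣m+n; ∣m⇒∣m*n; ∣n⇒∣m*n; ∣m⇒∣-m)
open import Data.Integer.DivMod using (_%ℕ_; _/ℕ_; a≡a%ℕn+[a/ℕn]*n; n%ℕd<d)
open import Data.Integer.Tactic.RingSolver using (solve-∀)
open import Algebra.Properties.CommutativeSemigroup ℤ.+-commutativeSemigroup
  using (interchange)
open import Algebra.Properties.CommutativeSemigroup ℤ.*-commutativeSemigroup
  using (x∙yz≈y∙xz)
open import Data.Product using (Σ; ∃-syntax; _×_; _,_; proj₁; proj₂)
open import Data.List using ([]; _∷_; _++_)
open import Data.List.Relation.Unary.All using (All; []; _∷_)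
open import Data.List.Relation.Unary.All.Properties using (++⁺)
open import Data.Unit using (tt)
open import Data.Empty using (⊥-elim)
open import Relation.Nullary using (¬_)
open import Relation.Binary.PropositionalEquality
  using (_≡_; refl; sym; trans; cong; cong₂; subst; module ≡-Reasoning)

⊕-assoc : ∀ x y z → (x ⊕ y) ⊕ z ≡ x ⊕ (y ⊕ z)
⊕-assoc (a , b) (c , d) (e , f) = cong₂ _,_ (ℤ.+-assoc a c e) (ℤ.+-assoc b d f)

⊕-identityˡ : ∀ x → 0O ⊕ x ≡ x
⊕-identityˡ (a , b) = cong₂ _,_ (ℤ.+-identityˡ a) (ℤ.+-identityˡ b)

⊕-identityʳ : ∀ x → x ⊕ 0O ≡ x
⊕-identityʳ (a , b) = cong₂ _,_ (ℤ.+-identityʳ a) (ℤ.+-identityʳ b)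

⊕-interchange : ∀ x y u v → (x ⊕ y) ⊕ (u ⊕ v) ≡ (x ⊕ u) ⊕ (y ⊕ v)
⊕-interchange (a , b) (c , d) (e , f) (g , h) =
  cong₂ _,_ (interchange a c e g) (interchange b d f h)

z·x≡α⊕z·u⇒α≡z·[x⊖u] : ∀ z x α u → z · x ≡ α ⊕ (z · u) → α ≡ z · (x ⊕ (⊖ u))
z·x≡α⊕z·u⇒α≡z·[x⊖u] z (a , b) (α₁ , α₂) (u₁ , u₂) eq =
  cong₂ _,_ (solveFor α₁ (cong proj₁ eq)) (solveFor α₂ (cong proj₂ eq))
  where
  solveFor : ∀ {a u} α → z ℤ.* a ≡ α + z ℤ.* u → α ≡ z ℤ.* (a + - u)
  solveFor {a} {u} α h = begin
    α                             ≡⟨ cancel α (z ℤ.* u) ⟩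
    (α + z ℤ.* u) - z ℤ.* u       ≡⟨ cong (_- z ℤ.* u) (sym h) ⟩
    z ℤ.* a - z ℤ.* u             ≡⟨ distrib z a u ⟩
    z ℤ.* (a + - u)               ∎
    where
    open ≡-Reasoning
    cancel : ∀ (α w : ℤ) → α ≡ (α + w) - w
    cancel = solve-∀
    distrib : ∀ (z a u : ℤ) → z ℤ.* a - z ℤ.* u ≡ z ℤ.* (a + - u)
    distrib = solve-∀

module _ (D : ℤ) where

  mul-zeroʳ : ∀ x → mul D x 0O ≡ 0O
  mul-zeroʳ (a , b) = cong₂ _,_ (l₁ a b (ωn D)) (l₂ a b (ωt D))
    where
    l₁ : ∀ (a b n : ℤ) → a ℤ.* + 0 + b ℤ.* + 0 ℤ.* n ≡ + 0
    l₁ = solve-∀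
    l₂ : ∀ (a b t : ℤ) → a ℤ.* + 0 + b ℤ.* + 0 + b ℤ.* + 0 ℤ.* t ≡ + 0
    l₂ = solve-∀

  mul-scalar : ∀ z x → mul D (z , + 0) x ≡ z · x
  mul-scalar z (a , b) = cong₂ _,_ (l₁ z a b (ωn D)) (l₂ z a b (ωt D))
    where
    l₁ : ∀ (z a b n : ℤ) → z ℤ.* a + + 0 ℤ.* b ℤ.* n ≡ z ℤ.* a
    l₁ = solve-∀
    l₂ : ∀ (z a b t : ℤ) → z ℤ.* b + + 0 ℤ.* a + + 0 ℤ.* b ℤ.* t ≡ z ℤ.* b
    l₂ = solve-∀

  mul-⊖1O : ∀ x → mul D (⊖ 1O) x ≡ ⊖ x
  mul-⊖1O x = trans (mul-scalar (- + 1) x) (cong₂ _,_ (ℤ.-1*i≡-i _) (ℤ.-1*i≡-i _))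

  mul-distribˡ-⊕ : ∀ x y z → mul D x (y ⊕ z) ≡ mul D x y ⊕ mul D x z
  mul-distribˡ-⊕ (a , b) (c , d) (e , f) =
    cong₂ _,_ (l₁ a b c d e f (ωn D)) (l₂ a b c d e f (ωt D))
    where
    l₁ : ∀ (a b c d e f n : ℤ) →
      a ℤ.* (c + e) + b ℤ.* (d + f) ℤ.* n
        ≡ (a ℤ.* c + b ℤ.* d ℤ.* n) + (a ℤ.* e + b ℤ.* f ℤ.* n)
    l₁ = solve-∀
    l₂ : ∀ (a b c d e f t : ℤ) →
      a ℤ.* (d + f) + b ℤ.* (c + e) + b ℤ.* (d + f) ℤ.* t
        ≡ (a ℤ.* d + b ℤ.* c + b ℤ.* d ℤ.* t) + (a ℤ.* f + b ℤ.* e + b ℤ.* f ℤ.* t)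
    l₂ = solve-∀

  mul-leftComm : ∀ x y z → mul D x (mul D y z) ≡ mul D y (mul D x z)
  mul-leftComm (a , b) (c , d) (e , f) =
    cong₂ _,_ (l₁ a b c d e f (ωn D) (ωt D)) (l₂ a b c d e f (ωn D) (ωt D))
    where
    l₁ : ∀ (a b c d e f n t : ℤ) →
      a ℤ.* (c ℤ.* e + d ℤ.* f ℤ.* n) + b ℤ.* (c ℤ.* f + d ℤ.* e + d ℤ.* f ℤ.* t) ℤ.* n
        ≡ c ℤ.* (a ℤ.* e + b ℤ.* f ℤ.* n) + d ℤ.* (a ℤ.* f + b ℤ.* e + b ℤ.* f ℤ.* t) ℤ.* n
    l₁ = solve-∀
    l₂ : ∀ (a b c d e f n t : ℤ) →
      a ℤ.* (c ℤ.* f + d ℤ.* e + d ℤ.* f ℤ.* t) + b ℤ.* (c ℤ.* e + d ℤ.* f ℤ.* n)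
        + b ℤ.* (c ℤ.* f + d ℤ.* e + d ℤ.* f ℤ.* t) ℤ.* t
        ≡ c ℤ.* (a ℤ.* f + b ℤ.* e + b ℤ.* f ℤ.* t) + d ℤ.* (a ℤ.* e + b ℤ.* f ℤ.* n)
          + d ℤ.* (a ℤ.* f + b ℤ.* e + b ℤ.* f ℤ.* t) ℤ.* t
    l₂ = solve-∀

  z≡[1⊖u]z⊕zu : ∀ u z → z ≡ mul D (1O ⊕ (⊖ u)) z ⊕ mul D z u
  z≡[1⊖u]z⊕zu (a , b) (e , f) = cong₂ _,_ (l₁ a b e f (ωn D)) (l₂ a b e f (ωt D))
    where
    l₁ : ∀ (a b e f n : ℤ) →
      e ≡ ((+ 1 + - a) ℤ.* e + (+ 0 + - b) ℤ.* f ℤ.* n) + (e ℤ.* a + f ℤ.* b ℤ.* n)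
    l₁ = solve-∀
    l₂ : ∀ (a b e f t : ℤ) →
      f ≡ ((+ 1 + - a) ℤ.* f + (+ 0 + - b) ℤ.* e + (+ 0 + - b) ℤ.* f ℤ.* t)
          + (e ℤ.* b + f ℤ.* a + f ℤ.* b ℤ.* t)
    l₂ = solve-∀

Ord-0O : ∀ n → Ord n 0O
Ord-0O n = n ℕ.∣0

Ord-⊕ : ∀ {n} x y → Ord n x → Ord n y → Ord n (x ⊕ y)
Ord-⊕ {n} (_ , b) (_ , d) n∣b n∣d = ∣⇒∣ᵤ (∣m∣n⇒∣m+n (∣ᵤ⇒∣ {+ n} {b} n∣b) (∣ᵤ⇒∣ {+ n} {d} n∣d))

Ord-mul : ∀ D {n} x y → Ord n x → Ord n y → Ord n (mul D x y)
Ord-mul D {n} (a , b) (c , d) n∣b n∣d =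
  ∣⇒∣ᵤ (∣m∣n⇒∣m+n (∣m∣n⇒∣m+n (∣n⇒∣m*n a d′) (∣m⇒∣m*n c b′)) (∣m⇒∣m*n (ωt D) (∣m⇒∣m*n d b′)))
  where
  b′ : + n ∣ b
  b′ = ∣ᵤ⇒∣ n∣b
  d′ : + n ∣ d
  d′ = ∣ᵤ⇒∣ n∣d

·-cancel-Ord : ∀ {n} c n′ .{{_ : NonZero c}} x → n ≡ c * n′ → Ord n ((+ c) · x) → Ord n′ x
·-cancel-Ord c n′ (_ , b) n≡cn′ n∣cb =
  Unsigned.*-cancelˡ-∣ (+ c) (subst (Unsigned._∣ (+ c ℤ.* b))
                                     (trans (cong +_ n≡cn′) (ℤ.pos-* c n′)) n∣cb)

mOk-0O : ∀ n → mOk n 0O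
mOk-0O n = Ord-0O n , Ord-0O n

mOk⊆Ord : ∀ n → mOk n ⊆ Ord n
mOk⊆Ord n x (_ , n∣b) = n∣b

mOk-⊕ : ∀ {n} x y → mOk n x → mOk n y → mOk n (x ⊕ y)
mOk-⊕ (a , b) (c , d) (n∣a , n∣b) (n∣c , n∣d) =
  Ord-⊕ (+ 0 , a) (+ 0 , c) n∣a n∣c , Ord-⊕ (a , b) (c , d) n∣b n∣d

mOk-mulˡ : ∀ D {n} r v → mOk n v → mOk n (mul D r v)
mOk-mulˡ D {n} (a , b) (c , d) (n∣c , n∣d) =
  ∣⇒∣ᵤ (∣m∣n⇒∣m+n (∣n⇒∣m*n a c′) (∣m⇒∣m*n (ωn D) (∣n⇒∣m*n b d′))) ,
  ∣⇒∣ᵤ (∣m∣n⇒∣m+n (∣m∣n⇒∣m+n (∣n⇒∣m*n a d′) (∣n⇒∣m*n b c′))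
                   (∣m⇒∣m*n (ωt D) (∣n⇒∣m*n b d′)))
  where
  c′ : + n ∣ c
  c′ = ∣ᵤ⇒∣ n∣c
  d′ : + n ∣ d
  d′ = ∣ᵤ⇒∣ n∣d

mOk-factor : ∀ {n} c n′ {v} → n ≡ c * n′ → mOk n v → ∃[ u ] mOk n′ u × v ≡ (+ c) · u
mOk-factor {n} c n′ {a , b} n≡cn′ (n∣a , n∣b)
  with ∣ᵤ⇒∣ {+ n} {a} n∣a | ∣ᵤ⇒∣ {+ n} {b} n∣b
... | divides p a≡pn | divides q b≡qn =
  (p ℤ.* + n′ , q ℤ.* + n′) , (∣⇒∣ᵤ (divides p refl) , ∣⇒∣ᵤ (divides q refl)) ,
  cong₂ _,_ (factor p a≡pn) (factor q b≡qn)
  where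
  factor : ∀ {a} p → a ≡ p ℤ.* + n → a ≡ + c ℤ.* (p ℤ.* + n′)
  factor {a} p a≡pn = begin
    a                         ≡⟨ a≡pn ⟩
    p ℤ.* + n                 ≡⟨ cong (λ k → p ℤ.* + k) n≡cn′ ⟩
    p ℤ.* + (c * n′)          ≡⟨ cong (p ℤ.*_) (ℤ.pos-* c n′) ⟩
    p ℤ.* (+ c ℤ.* + n′)      ≡⟨ x∙yz≈y∙xz p (+ c) (+ n′) ⟩
    + c ℤ.* (p ℤ.* + n′)      ∎
    where open ≡-Reasoning

module _ {D : ℤ} {n : ℕ} {I : Subset} (I-ideal : IsIdeal D n I) where
  open IsIdeal I-ideal

  ·-closed : ∀ z {x} → I x → I (z · x)
  ·-closed z {x} x∈I = subst I (mul-scalar D z x) (mul-cl (z , + 0) x (Ord-0O n) x∈I)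

  ⊆+S-mOk : I ⊆ (I +S mOk n)
  ⊆+S-mOk x x∈I = x , 0O , x∈I , mOk-0O n , sym (⊕-identityʳ x)

  mOk⊆+S-mOk : mOk n ⊆ (I +S mOk n)
  mOk⊆+S-mOk v v∈mOk = 0O , v , zero∈ , v∈mOk , sym (⊕-identityˡ v)

mul-cl⇒neg-cl : ∀ D {n} (I : Subset) → (∀ r x → Ord n r → I x → I (mul D r x)) →
                ∀ x → I x → I (⊖ x)
mul-cl⇒neg-cl D {n} I mul-cl x x∈I =
  subst I (mul-⊖1O D x) (mul-cl (⊖ 1O) x (Ord-0O n) x∈I)

+S-mOk-isIdeal : ∀ {D n I} → IsIdeal D n I → IsIdeal D n (I +S mOk n)
+S-mOk-isIdeal {D} {n} {I} I-ideal = record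
  { sub    = λ { _ (u , v , u∈I , v∈mOk , refl) → Ord-⊕ u v (sub u u∈I) (mOk⊆Ord n v v∈mOk) }
  ; zero∈  = mOk⊆+S-mOk I-ideal 0O (mOk-0O n)
  ; +-cl   = +-cl′
  ; neg-cl = mul-cl⇒neg-cl D (I +S mOk n) mul-cl′
  ; mul-cl = mul-cl′
  }
  where
  open IsIdeal I-ideal

  +-cl′ : ∀ x y → (I +S mOk n) x → (I +S mOk n) y → (I +S mOk n) (x ⊕ y)
  +-cl′ _ _ (u , v , u∈I , v∈mOk , refl) (u′ , v′ , u′∈I , v′∈mOk , refl) =
    u ⊕ u′ , v ⊕ v′ , +-cl u u′ u∈I u′∈I , mOk-⊕ v v′ v∈mOk v′∈mOk , ⊕-interchange u v u′ v′

  mul-cl′ : ∀ r x → Ord n r → (I +S mOk n) x → (I +S mOk n) (mul D r x)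
  mul-cl′ r _ r∈Ord (u , v , u∈I , v∈mOk , refl) =
    mul D r u , mul D r v , mul-cl r u r∈Ord u∈I , mOk-mulˡ D r v v∈mOk ,
    mul-distribˡ-⊕ D r u v

integerPart-∈ : ∀ {D n I a b} → IsIdeal D n I → mOk n ⊆ I → I (a , b) → I (a , + 0)
integerPart-∈ {n = n} {I} {a} {b} I-ideal mOk⊆I ab∈I =
  subst I (cong₂ _,_ (ℤ.+-identityʳ a) (ℤ.+-inverseʳ b))
    (+-cl _ _ ab∈I (mOk⊆I (+ 0 , - b) (Ord-0O n , ∣⇒∣ᵤ (∣m⇒∣-m (∣ᵤ⇒∣ {+ n} {b} (sub _ ab∈I))))))
  where open IsIdeal I-ideal

module LeastPositiveInteger
  {D : ℤ} {n : ℕ} {I : Subset} (I-ideal : IsIdeal D n I) (mOk⊆I : mOk n ⊆ I)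
  (c : ℕ) .{{_ : NonZero c}} (c∈I : I ((+ c) · 1O))
  (least : ∀ c′ → 0 < c′ → c′ < c → ¬ I ((+ c′) · 1O))
  where
  open IsIdeal I-ideal

  ∣-integer : ∀ {a} → I (a , + 0) → + c ∣ a
  ∣-integer {a} a∈I with a %ℕ c | a≡a%ℕn+[a/ℕn]*n a c | n%ℕd<d a c
  ... | zero  | a≡0+qc | _   = divides (a /ℕ c) (trans a≡0+qc (ℤ.+-identityˡ _))
  ... | suc r | a≡r+qc | r<c = ⊥-elim (least (suc r) z<s r<c r∈I)
    where
    q : ℤ
    q = a /ℕ c
    remainder : ∀ (a r q c : ℤ) → a ≡ r + q ℤ.* c →
                (a + - q ℤ.* (c ℤ.* + 1) , + 0 + - q ℤ.* (c ℤ.* + 0)) ≡ r · 1O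
    remainder a r q c refl = cong₂ _,_ (l₁ r q c) (l₂ r q c)
      where
      l₁ : ∀ (r q c : ℤ) → r + q ℤ.* c + - q ℤ.* (c ℤ.* + 1) ≡ r ℤ.* + 1
      l₁ = solve-∀
      l₂ : ∀ (r q c : ℤ) → + 0 + - q ℤ.* (c ℤ.* + 0) ≡ r ℤ.* + 0
      l₂ = solve-∀
    r∈I : I ((+ suc r) · 1O)
    r∈I = subst I (remainder a (+ suc r) q (+ c) a≡r+qc)
                  (+-cl _ _ a∈I (·-closed I-ideal (- q) c∈I))

  c∣n : c ℕ.∣ n
  c∣n = ∣⇒∣ᵤ (∣-integer (mOk⊆I (+ n , + 0) (ℕ.∣-refl , Ord-0O n)))

  ≐c·Ord : ∀ {n′} → n ≡ c * n′ → I ≐ ((+ c) ·S Ord n′)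
  ≐c·Ord {n′} n≡cn′ = ⊆c·Ord , c·Ord⊆
    where
    +n≡+c*+n′ : + n ≡ + c ℤ.* + n′
    +n≡+c*+n′ = trans (cong +_ n≡cn′) (ℤ.pos-* c n′)

    ⊆c·Ord : I ⊆ ((+ c) ·S Ord n′)
    ⊆c·Ord (a , b) ab∈I
      with ∣-integer (integerPart-∈ I-ideal mOk⊆I ab∈I) | ∣ᵤ⇒∣ {+ n} {b} (sub _ ab∈I)
    ... | divides a′ a≡a′c | divides b′ b≡b′n =
      (a′ , b′ ℤ.* + n′) , ∣⇒∣ᵤ (divides b′ refl) ,
      cong₂ _,_ (trans a≡a′c (ℤ.*-comm a′ (+ c)))
                (begin
                  b                         ≡⟨ b≡b′n ⟩
                  b′ ℤ.* + n                ≡⟨ cong (b′ ℤ.*_) +n≡+c*+n′ ⟩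
                  b′ ℤ.* (+ c ℤ.* + n′)     ≡⟨ x∙yz≈y∙xz b′ (+ c) (+ n′) ⟩
                  + c ℤ.* (b′ ℤ.* + n′)     ∎)
      where open ≡-Reasoning

    c·Ord⊆ : ((+ c) ·S Ord n′) ⊆ I
    c·Ord⊆ _ ((y₁ , y₂) , n′∣y₂ , refl) =
      subst I (sym (cong₂ _,_ (l₁ (+ c) y₁) (l₂ (+ c) y₁ y₂)))
        (+-cl _ _ (·-closed I-ideal y₁ c∈I) (mOk⊆I (+ 0 , + c ℤ.* y₂) (Ord-0O n , n∣cy₂)))
      where
      n∣cy₂ : Ord n (+ 0 , + c ℤ.* y₂)
      n∣cy₂ = subst (Unsigned._∣ (+ c ℤ.* y₂)) (sym +n≡+c*+n′)
                    (Unsigned.*-monoʳ-∣ (+ c) n′∣y₂)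
      l₁ : ∀ (c y₁ : ℤ) → c ℤ.* y₁ ≡ y₁ ℤ.* (c ℤ.* + 1) + + 0
      l₁ = solve-∀
      l₂ : ∀ (c y₁ y₂ : ℤ) → c ℤ.* y₂ ≡ y₁ ℤ.* (c ℤ.* + 0) + c ℤ.* y₂
      l₂ = solve-∀

module _ (D : ℤ) {A B : Subset} where

  sumProd-++ : ∀ ps qs → sumProd D (ps ++ qs) ≡ sumProd D ps ⊕ sumProd D qs
  sumProd-++ []              qs = sym (⊕-identityˡ _)
  sumProd-++ ((x , y) ∷ ps) qs =
    trans (cong (mul D x y ⊕_) (sumProd-++ ps qs)) (sym (⊕-assoc (mul D x y) _ _))

  ProdS-0O : ProdS D A B 0O
  ProdS-0O = [] , [] , refl

  ProdS-⊕ : ∀ {x y} → ProdS D A B x → ProdS D A B y → ProdS D A B (x ⊕ y)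
  ProdS-⊕ (ps , ps-ok , refl) (qs , qs-ok , refl) =
    ps ++ qs , ++⁺ ps-ok qs-ok , sym (sumProd-++ ps qs)

  ProdS-mul : ∀ {x y} → A x → B y → ProdS D A B (mul D x y)
  ProdS-mul {x} {y} x∈A y∈B =
    (x , y) ∷ [] , (x∈A , y∈B) ∷ [] , sym (⊕-identityʳ (mul D x y))

  ProdS-ind : (C : Subset) → C 0O → (∀ {x y} → C x → C y → C (x ⊕ y)) →
              (∀ {x y} → A x → B y → C (mul D x y)) → ProdS D A B ⊆ C
  ProdS-ind C C-0O C-⊕ C-mul _ (ps , ps-ok , refl) = go ps ps-ok
    where
    go : ∀ ps → All (λ { (x , y) → A x × B y }) ps → C (sumProd D ps)
    go []             []                    = C-0O
    go ((x , y) ∷ ps) ((x∈A , y∈B) ∷ ps-ok) = C-⊕ (C-mul x∈A y∈B) (go ps ps-ok)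

  ProdS-mulˡ : ∀ r → (∀ {y} → B y → B (mul D r y)) → ProdS D A B ⊆ (λ z → ProdS D A B (mul D r z))
  ProdS-mulˡ r rB⊆B = ProdS-ind (λ z → ProdS D A B (mul D r z))
    (subst (ProdS D A B) (sym (mul-zeroʳ D r)) ProdS-0O)
    (λ {x} {y} rx∈P ry∈P → subst (ProdS D A B) (sym (mul-distribˡ-⊕ D r x y)) (ProdS-⊕ rx∈P ry∈P))
    (λ {x} {y} x∈A y∈B → subst (ProdS D A B) (sym (mul-leftComm D r x y)) (ProdS-mul x∈A (rB⊆B y∈B)))

module _ (D : ℤ) {n : ℕ} {A : Subset} (A⊆Ord : A ⊆ Ord n) where

  ProdS-Ord⊆Ord : ProdS D A (Ord n) ⊆ Ord n
  ProdS-Ord⊆Ord = ProdS-ind D (Ord n) (Ord-0O n) (λ {x} {y} → Ord-⊕ x y)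
    (λ {x} {y} x∈A y∈Ord → Ord-mul D x y (A⊆Ord x x∈A) y∈Ord)

  ProdS-Ord-isIdeal : IsIdeal D n (ProdS D A (Ord n))
  ProdS-Ord-isIdeal = record
    { sub    = ProdS-Ord⊆Ord
    ; zero∈  = ProdS-0O D
    ; +-cl   = λ _ _ → ProdS-⊕ D
    ; neg-cl = mul-cl⇒neg-cl D (ProdS D A (Ord n)) mul-cl′
    ; mul-cl = mul-cl′
    }
    where
    mul-cl′ : ∀ r x → Ord n r → ProdS D A (Ord n) x → ProdS D A (Ord n) (mul D r x)
    mul-cl′ r x r∈Ord = ProdS-mulˡ D r (λ {y} → Ord-mul D r y r∈Ord) x

  ProdS-Ord+S-mOk≐Ord : (∃[ u ] mOk n u × A (1O ⊕ (⊖ u))) → (ProdS D A (Ord n) +S mOk n) ≐ Ord n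
  ProdS-Ord+S-mOk≐Ord (u , u∈mOk , 1-u∈A) = ⊆Ord , Ord⊆
    where
    ⊆Ord : (ProdS D A (Ord n) +S mOk n) ⊆ Ord n
    ⊆Ord _ (p , v , p∈P , v∈mOk , refl) = Ord-⊕ p v (ProdS-Ord⊆Ord p p∈P) (mOk⊆Ord n v v∈mOk)

    Ord⊆ : Ord n ⊆ (ProdS D A (Ord n) +S mOk n)
    Ord⊆ z z∈Ord = mul D (1O ⊕ (⊖ u)) z , mul D z u , ProdS-mul D 1-u∈A z∈Ord ,
                   mOk-mulˡ D z u u∈mOk , z≡[1⊖u]z⊕zu D u z

lemma5p2 : (D : ℤ) → SquareFree D → (m : ℕ) → 0 < m →
    (𝔞 : Subset) → IsIdeal D m 𝔞 →
    (c : ℕ) → 0 < c → (𝔞 +S mOk m) ((+ c) · 1O) →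
    (∀ c' → 0 < c' → c' < c → ¬ ((𝔞 +S mOk m) ((+ c') · 1O))) →
    Σ ℕ (λ m' → (m ≡ c * m')
      × ((𝔞 +S mOk m) ≐ ((+ c) ·S Ord m'))
      × (𝔞 ⊆ ((+ c) ·S Ok))
      × IsIdeal D m' (ProdS D (inv·S (+ c) 𝔞) (Ord m'))
      × ((ProdS D (inv·S (+ c) 𝔞) (Ord m') +S mOk m') ≐ Ord m'))
lemma5p2 D _ m _ 𝔞 𝔞-ideal c@(suc _) _ c∈S@(α , v , α∈𝔞 , v∈mOk , c≡α+v) least =
  m′ , m≡cm′ , S≐c·Ord , 𝔞⊆c·Ok ,
  ProdS-Ord-isIdeal D c⁻¹𝔞⊆Ord , ProdS-Ord+S-mOk≐Ord D c⁻¹𝔞⊆Ord c⁻¹𝔞∋1-mod-m′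
  where
  open LeastPositiveInteger (+S-mOk-isIdeal 𝔞-ideal) (mOk⊆+S-mOk 𝔞-ideal) c c∈S least
  m′ : ℕ
  m′ = ℕ.quotient c∣n
  m≡cm′ : m ≡ c * m′
  m≡cm′ = ℕ.m∣n⇒n≡m*quotient c∣n
  S≐c·Ord : (𝔞 +S mOk m) ≐ ((+ c) ·S Ord m′)
  S≐c·Ord = ≐c·Ord m≡cm′

  𝔞⊆c·Ok : 𝔞 ⊆ ((+ c) ·S Ok)
  𝔞⊆c·Ok x x∈𝔞 with proj₁ S≐c·Ord x (⊆+S-mOk 𝔞-ideal x x∈𝔞)
  ... | y , _ , x≡cy = y , tt , x≡cy

  c⁻¹𝔞⊆Ord : inv·S (+ c) 𝔞 ⊆ Ord m′
  c⁻¹𝔞⊆Ord x cx∈𝔞 = ·-cancel-Ord c m′ x m≡cm′ (IsIdeal.sub 𝔞-ideal _ cx∈𝔞)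

  c⁻¹𝔞∋1-mod-m′ : ∃[ u ] mOk m′ u × inv·S (+ c) 𝔞 (1O ⊕ (⊖ u))
  c⁻¹𝔞∋1-mod-m′ with mOk-factor c m′ m≡cm′ v∈mOk
  ... | u , u∈mOk , v≡cu = u , u∈mOk ,
    subst 𝔞 (z·x≡α⊕z·u⇒α≡z·[x⊖u] (+ c) 1O α u (trans c≡α+v (cong (α ⊕_) v≡cu))) α∈𝔞
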